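{- Let $n\ge1$ and $\mathbf{v}=\sum_{k\in[n]}(\mathbf{e}_{2k}-\mathbf{e}_{2k-1})=(-1,1,\dots,-1,1)\in\mathbb{R}^{2n}$. Let $\alpha_0=(0,1,\varnothing,\varnothing)$ and, for $i\in[n]$, $\underline{\alpha}_i=(0,i+1,[i],\varnothing)$ and $\overline{\alpha}_i=(0,i+1,\varnothing,[i])$. Then $T_\leftarrow=\{\alpha_0\}\cup\bigcup_{i\in[n]}\{\underline{\alpha}_i,\overline{\alpha}_i\}$ is the only wiggly pseudotriangulation $T$ such that $\mathbf{v}$ lies in the cone $\mathbb{R}_{\ge0}\,\mathbf{g}(T)$ generated by the $\mathbf{g}$-vectors of the internal arcs of $T$.
   Context: Points $0,\dots,n+1$ on a horizontal line. A wiggly arc is $(i,j,A,B)$ with $0\le i<j\le n+1$ and $A\sqcup B=\{i+1,\dots,j-1\}$ (curve from $i$ to $j$ above $A$, below $B$); $(0,n+1,[n],\varnothing)$ and $(0,n+1,\varnothing,[n])$ are external, others internal. Arcs $(i,j,A,B)$, $(i',j',A',B')$ are non pointed if $i=j'$ or $i'=j$; crossing if $(A\cap B')\cup(\{i,j\}\cap B')\cup(A\cap\{i',j'\})\ne\varnothing\ne(A'\cap B)\cup(\{i',j'\}\cap B)\cup(A'\cap\{i,j\})$; compatible if neither. A wiggly pseudotriangulation is an inclusion-maximal set of pairwise compatible arcs containing both external arcs. For $\alpha=(i,j,A,B)$: $\alpha^+=(\{2i-1,2j\}\setminus\{ -1,2n+2\})\cup\{2a-1,2a:a\in A\}$, $\alpha^-=(\{2i,2j-1\}\setminus\{0,2n+1\})\cup\{2b-1,2b:b\in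 B\}$, $\mathbf{g}(\alpha)=\pi(\mathbf{1}_{\alpha^+}-\mathbf{1}_{\alpha^- })$ where $\pi$ is the orthogonal projection of $\mathbb{R}^{2n}$ onto $\{\mathbf{x}:\sum_k x_k=0\}$; $\mathbf{g}(T)=\{\mathbf{g}(\alpha):\alpha\in T\text{ internal}\}$.
   Formalization: Vectors of $\mathbb{R}^{2n}$ have rational coordinates, and the cone ℝ≥0 g(T) consists of nonnegative rational combinations of the g-vectors rather than real ones. -}

module Defs where

open import Data.Nat as ℕ using (ℕ; zero; suc; _<_; _≤_; _∸_; _≡ᵇ_; _≤ᵇ_)
open import Data.Fin using (Fin; toℕ)
open import Data.Fin.Subset using (Subset; _∈_; ⊥)
open import Data.Vec using (tabulate; lookup)
open import Data.List using (List; map; foldr; allFin)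
open import Data.Bool.ListAction using (any)
open import Data.List.Relation.Unary.All using (All)
open import Data.Bool using (Bool; true; false; _∧_; _∨_; not; if_then_else_)
open import Data.Product using (Σ; _×_; _,_; ∃)
open import Data.Sum using (_⊎_)
open import Data.Integer using (+_; -[1+_])
open import Data.Rational as ℚ using (ℚ; 0ℚ; 1ℚ; _/_)
open import Relation.Nullary using (¬_)
open import Relation.Binary.PropositionalEquality using (_≡_; _≢_)
open import Level using (Level) renaming (suc to lsuc)

-- Wiggly arcs on the points 0,…,n+1.
-- An arc (i , j , A , B): endpoints i j : ℕ, and A B are subsets of the
-- set of points {0,…,n+1} (encoded as Fin (2 ℕ.+ n), point k ↦ toℕ k).

record Arc (n : ℕ) : Set where
  constructor arc
  field
    i j : ℕ
    A B : Subset (2 ℕ.+ n)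
open Arc public

IsArc : (n : ℕ) → Arc n → Set
IsArc n α =
  (i α < j α) × (j α ≤ suc n)
  × (∀ (k : Fin (2 ℕ.+ n)) → ¬ (k ∈ A α × k ∈ B α))
  × (∀ (k : Fin (2 ℕ.+ n)) →
       ((k ∈ A α ⊎ k ∈ B α) → (i α < toℕ k × toℕ k < j α))
     × ((i α < toℕ k × toℕ k < j α) → (k ∈ A α ⊎ k ∈ B α)))

interval : (n m : ℕ) → Subset (2 ℕ.+ n)
interval n m = tabulate (λ k → (1 ≤ᵇ toℕ k) ∧ (toℕ k ≤ᵇ m))

extBelow extAbove : (n : ℕ) → Arc n
extBelow n = arc 0 (suc n) (interval n n) ⊥
extAbove n = arc 0 (suc n) ⊥ (interval n n)

Internal : (n : ℕ) → Arc n → Set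
Internal n α = (α ≢ extBelow n) × (α ≢ extAbove n)

NonPointed : {n : ℕ} → Arc n → Arc n → Set
NonPointed α β = (i α ≡ j β) ⊎ (i β ≡ j α)

Meets : {n : ℕ} → Arc n → Arc n → Set
Meets {n} α β = ∃ λ (k : Fin (2 ℕ.+ n)) →
    (k ∈ A α × k ∈ B β)
  ⊎ (((toℕ k ≡ i α) ⊎ (toℕ k ≡ j α)) × k ∈ B β)
  ⊎ (k ∈ A α × ((toℕ k ≡ i β) ⊎ (toℕ k ≡ j β)))

Crossing : {n : ℕ} → Arc n → Arc n → Set
Crossing α β = Meets α β × Meets β α

Compatible : {n : ℕ} → Arc n → Arc n → Set
Compatible α β = ¬ NonPointed α β × ¬ Crossing α β

ArcSet : ℕ → Set₁
ArcSet n = Arc n → Set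

_⊆A_ : {n : ℕ} → ArcSet n → ArcSet n → Set
S ⊆A T = ∀ α → S α → T α

AllArcs : (n : ℕ) → ArcSet n → Set
AllArcs n S = ∀ α → S α → IsArc n α

PairwiseCompatible : {n : ℕ} → ArcSet n → Set
PairwiseCompatible S = ∀ α β → S α → S β → α ≢ β → Compatible α β

IsWigglyPseudotriangulation : (n : ℕ) → ArcSet n → Set₁
IsWigglyPseudotriangulation n T =
  AllArcs n T
  × T (extBelow n) × T (extAbove n)
  × PairwiseCompatible T
  × (∀ (S : ArcSet n) → AllArcs n S → T ⊆A S → PairwiseCompatible S → S ⊆A T)

-- g-vectors. Vectors of ℚ^d are functions Fin d → ℚ; coordinate x : Fin (2 * n)
-- is the coordinate number c = toℕ x + 1 ∈ {1,…,2n}.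

Vect : ℕ → Set
Vect d = Fin d → ℚ

sumV : {d : ℕ} → Vect d → ℚ
sumV {d} x = foldr ℚ._+_ 0ℚ (map x (allFin d))

proj : (d : ℕ) → Vect d → Vect d
proj zero x = x
proj (suc m) x k = x k ℚ.- (sumV x ℚ.* ((+ 1) / suc m))

inDoubled : {n : ℕ} → Subset (2 ℕ.+ n) → ℕ → Bool
inDoubled {n} S c =
  any (λ a → lookup S a ∧ ((c ≡ᵇ (2 ℕ.* toℕ a) ∸ 1) ∨ (c ≡ᵇ 2 ℕ.* toℕ a)))
      (allFin (2 ℕ.+ n))

-- α⁺ = ({2i-1, 2j} ∖ {-1, 2n+2}) ∪ {2a-1, 2a : a ∈ A}   (as a Boolean predicate on ℕ)
inPlus : (n : ℕ) → Arc n → ℕ → Bool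
inPlus n α c =
  (not (i α ≡ᵇ 0) ∧ (c ≡ᵇ (2 ℕ.* i α) ∸ 1))
  ∨ (not (j α ≡ᵇ suc n) ∧ (c ≡ᵇ 2 ℕ.* j α))
  ∨ inDoubled (A α) c

inMinus : (n : ℕ) → Arc n → ℕ → Bool
inMinus n α c =
  (not (i α ≡ᵇ 0) ∧ (c ≡ᵇ 2 ℕ.* i α))
  ∨ (not (j α ≡ᵇ suc n) ∧ (c ≡ᵇ (2 ℕ.* j α) ∸ 1))
  ∨ inDoubled (B α) c

indicator : Bool → ℚ
indicator b = if b then 1ℚ else 0ℚ

gvec : (n : ℕ) → Arc n → Vect (2 ℕ.* n)
gvec n α = proj (2 ℕ.* n)
  (λ x → indicator (inPlus n α (suc (toℕ x))) ℚ.- indicator (inMinus n α (suc (toℕ x))))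

InCone : (n : ℕ) → ArcSet n → Vect (2 ℕ.* n) → Set
InCone n T v = ∃ λ (cs : List (Arc n × ℚ)) →
    All (λ p → T (Data.Product.proj₁ p) × Internal n (Data.Product.proj₁ p)
               × (0ℚ ℚ.≤ Data.Product.proj₂ p)) cs
  × (∀ (x : Fin (2 ℕ.* n)) →
       v x ≡ foldr ℚ._+_ 0ℚ
               (map (λ p → Data.Product.proj₂ p ℚ.* gvec n (Data.Product.proj₁ p) x) cs))

vvec : (n : ℕ) → Vect (2 ℕ.* n)
vvec n x = foldr ℚ._+_ 0ℚ
      (map (λ k → indicator (suc (toℕ x) ≡ᵇ 2 ℕ.* suc (toℕ k))
                  ℚ.- indicator (suc (toℕ x) ≡ᵇ (2 ℕ.* suc (toℕ k)) ∸ 1))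
           (allFin n))

alpha0 : (n : ℕ) → Arc n
alpha0 n = arc 0 1 ⊥ ⊥

alphaUnder alphaOver : (n : ℕ) → ℕ → Arc n
alphaUnder n m = arc 0 (suc m) (interval n m) ⊥
alphaOver  n m = arc 0 (suc m) ⊥ (interval n m)

Tleft : (n : ℕ) → ArcSet n
Tleft n α = (α ≡ alpha0 n)
  ⊎ (Σ ℕ λ m → (1 ≤ m) × (m ≤ n) × ((α ≡ alphaUnder n m) ⊎ (α ≡ alphaOver n m)))

-- The g-vector of an arc α is read off point by point: an inner point k contributes to the
-- coordinates 2k − 1 and 2k only according to whether it is the source or the target of α or lies
-- in A or in B. T_← is the fan of arcs leaving 0. It is pairwise compatible, and maximal because
-- every point k ≥ 1 is the target of an arc of T_← (so a compatible arc starts at 0) and every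
-- change of side between consecutive points k, k + 1 is crossed by an arc of T_← ending at k + 1.
-- The arcs of T_← ending at k ≤ n contribute exactly e₂ₖ − e₂ₖ₋₁ to v (the arcs α̲ᵢ, ᾱᵢ with
-- weight ½ each), which puts v in their cone. Conversely, let v lie in the cone of T. A functional
-- x ↦ Σ (x_a − x_b) kills the projection π; if it is nonnegative on g(α) for all α ∈ T, it is
-- nonnegative on v. Taking x₂ₖ₋₁ − x₂ₖ at a source k ≥ 1, of which no arc of T is the target,
-- shows that all arcs of T leave 0; a suitable combination of the coordinates of k and k + 1 shows
-- that no arc of T changes side between k and k + 1. Hence T ⊆ T_←, and maximality of T gives equality.

module Submission where

open import Defs
open import Algebra.Bundles using (CommutativeMonoid)
import Algebra.Properties.CommutativeMonoid.Sum as MonoidSum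
open import Data.Bool using (Bool; true; false; _∧_; _∨_; not; T)
open import Data.Bool.Properties using (∧-zeroʳ; ∧-identityʳ; ∨-identityʳ; ∨-commutativeMonoid; T-≡; T-∧)
open import Data.Empty using (⊥; ⊥-elim)
open import Data.Fin as Fin using (Fin; toℕ; fromℕ<; inject₁; punchIn)
open import Data.Fin.Properties using (toℕ-injective; toℕ-fromℕ<; toℕ-inject₁; toℕ<n; punchInᵢ≢i)
open import Data.Fin.Subset using (Subset; _∈_; _∉_) renaming (⊥ to ∅)
open import Data.Fin.Subset.Properties using (_∈?_; ∉⊥; ⊆-antisym; Empty-unique)
open import Data.List as List using (List; []; _∷_; _++_; concatMap; allFin)
open import Data.List.Properties using (map-cong; map-tabulate)
open import Data.List.Relation.Unary.All using (All; []; _∷_)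
import Data.List.Relation.Unary.All.Properties as All
open import Data.Nat as ℕ using (ℕ; zero; suc; _≤_; _<_; z≤n; s≤s; _≡ᵇ_; _≤ᵇ_; _∸_)
open import Data.Nat.Properties as ℕP using (_≟_; *-suc; even≢odd)
open import Data.Product using (∃; ∃₂; _×_; _,_; proj₁; proj₂; uncurry′)
open import Data.Integer using () renaming (+_ to ℤ+)
open import Data.Rational as ℚ using (ℚ; 0ℚ; 1ℚ; _+_; _-_; _*_)
import Data.Rational.Properties as ℚP
open import Data.Rational.Solver using (module +-*-Solver)
open import Data.Sum using (_⊎_; inj₁; inj₂; [_,_]; swap) renaming (map to ⊎-map)
open import Data.Vec using (lookup)
import Data.Vec.Properties as Vecₚ
import Data.Vec.Functional as Vector
open import Function using (id; _∘_; const; case_of_)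
open import Function.Bundles using (Equivalence)
open import Relation.Nullary using (¬_; yes; no)
open import Relation.Nullary.Decidable using (dec-true; dec-false)
open import Relation.Binary using (tri<; tri≈; tri>)
open import Relation.Binary.PropositionalEquality using (_≡_; _≢_; refl; sym; trans; cong; cong₂; subst; subst₂; module ≡-Reasoning)
open +-*-Solver using (solve; _:+_; _:-_; _:*_; _:=_; con)

≡ᵇ-true : ∀ {m n} → m ≡ n → (m ≡ᵇ n) ≡ true
≡ᵇ-true {m} {n} = dec-true (m ≟ n)

≡ᵇ-false : ∀ {m n} → m ≢ n → (m ≡ᵇ n) ≡ false
≡ᵇ-false {m} {n} = dec-false (m ≟ n)

≡ᵇ-sound : ∀ {m n} → (m ≡ᵇ n) ≡ true → m ≡ n
≡ᵇ-sound {m} {n} e = ℕP.≡ᵇ⇒≡ m n (subst T (sym e) _)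

2*m≡ᵇ2*n : ∀ m n → (2 ℕ.* m ≡ᵇ 2 ℕ.* n) ≡ (m ≡ᵇ n)
2*m≡ᵇ2*n m n with m ≟ n
... | yes refl = trans (≡ᵇ-true {2 ℕ.* m} refl) (sym (≡ᵇ-true {m} refl))
... | no m≢n  = trans (≡ᵇ-false (m≢n ∘ ℕP.*-cancelˡ-≡ m n 2)) (sym (≡ᵇ-false m≢n))

1+2*m≡ᵇ2*n : ∀ m n → (suc (2 ℕ.* m) ≡ᵇ 2 ℕ.* n) ≡ false
1+2*m≡ᵇ2*n m n = ≡ᵇ-false (even≢odd n m ∘ sym)

1+2*m≡ᵇ2*n∸1 : ∀ m n → (suc (2 ℕ.* m) ≡ᵇ 2 ℕ.* n ∸ 1) ≡ (suc m ≡ᵇ n)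
1+2*m≡ᵇ2*n∸1 m zero = refl
1+2*m≡ᵇ2*n∸1 m (suc n) = trans (cong (λ t → suc (2 ℕ.* m) ≡ᵇ t ∸ 1) (*-suc 2 n)) (2*m≡ᵇ2*n m n)

2+2*m≡ᵇ2*n : ∀ m n → (suc (suc (2 ℕ.* m)) ≡ᵇ 2 ℕ.* n) ≡ (suc m ≡ᵇ n)
2+2*m≡ᵇ2*n m zero = refl
2+2*m≡ᵇ2*n m (suc n) = trans (cong (suc (suc (2 ℕ.* m)) ≡ᵇ_) (*-suc 2 n)) (2*m≡ᵇ2*n m n)

2+2*m≡ᵇ2*n∸1 : ∀ m n → (suc (suc (2 ℕ.* m)) ≡ᵇ 2 ℕ.* n ∸ 1) ≡ false
2+2*m≡ᵇ2*n∸1 m zero = refl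
2+2*m≡ᵇ2*n∸1 m (suc n) = trans (cong (λ t → suc (suc (2 ℕ.* m)) ≡ᵇ t ∸ 1) (*-suc 2 n)) (1+2*m≡ᵇ2*n m n)

sumBy : {X : Set} → (X → ℚ) → List X → ℚ
sumBy f xs = List.foldr _+_ 0ℚ (List.map f xs)

module _ {X : Set} where

  sumBy-cong : ∀ {f g : X → ℚ} → (∀ a → f a ≡ g a) → ∀ xs → sumBy f xs ≡ sumBy g xs
  sumBy-cong f≗g xs = cong (List.foldr _+_ 0ℚ) (map-cong f≗g xs)

  sumBy-+ : ∀ (f g : X → ℚ) xs → sumBy (λ a → f a + g a) xs ≡ sumBy f xs + sumBy g xs
  sumBy-+ f g [] = refl
  sumBy-+ f g (a ∷ xs) = trans (cong (f a + g a +_) (sumBy-+ f g xs))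
    (solve 4 (λ u v s t → (u :+ v) :+ (s :+ t) := (u :+ s) :+ (v :+ t)) refl (f a) (g a) (sumBy f xs) (sumBy g xs))

  sumBy-* : ∀ c (f : X → ℚ) xs → sumBy (λ a → c * f a) xs ≡ c * sumBy f xs
  sumBy-* c f [] = sym (ℚP.*-zeroʳ c)
  sumBy-* c f (a ∷ xs) = trans (cong (c * f a +_) (sumBy-* c f xs)) (sym (ℚP.*-distribˡ-+ c (f a) (sumBy f xs)))

  sumBy-++ : ∀ (f : X → ℚ) xs ys → sumBy f (xs ++ ys) ≡ sumBy f xs + sumBy f ys
  sumBy-++ f [] ys = sym (ℚP.+-identityˡ (sumBy f ys))
  sumBy-++ f (a ∷ xs) ys = trans (cong (f a +_) (sumBy-++ f xs ys)) (sym (ℚP.+-assoc (f a) (sumBy f xs) (sumBy f ys)))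

  sumBy-nonneg : ∀ {P : X → Set} (f : X → ℚ) → (∀ {a} → P a → 0ℚ ℚ.≤ f a) →
                 ∀ {xs} → All P xs → 0ℚ ℚ.≤ sumBy f xs
  sumBy-nonneg f nonneg [] = ℚP.≤-refl
  sumBy-nonneg f nonneg (pa ∷ pxs) = ℚP.+-mono-≤ (nonneg pa) (sumBy-nonneg f nonneg pxs)

sumBy-concatMap : ∀ {X Y : Set} (f : Y → ℚ) (g : X → List Y) xs → sumBy f (concatMap g xs) ≡ sumBy (sumBy f ∘ g) xs
sumBy-concatMap f g [] = refl
sumBy-concatMap f g (a ∷ xs) = trans (sumBy-++ f (g a) (concatMap g xs)) (cong (sumBy f (g a) +_) (sumBy-concatMap f g xs))

foldr-map-allFin : ∀ {A B : Set} (_∙_ : A → B → B) e {m} (f : Fin m → A) →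
                   List.foldr _∙_ e (List.map f (allFin m)) ≡ Vector.foldr _∙_ e f
foldr-map-allFin _∙_ e f = trans (cong (List.foldr _∙_ e) (map-tabulate (λ a → a) f)) (foldr-tabulate f)
  where
  foldr-tabulate : ∀ {m} (g : Fin m → _) → List.foldr _∙_ e (List.tabulate g) ≡ Vector.foldr _∙_ e g
  foldr-tabulate {zero} g = refl
  foldr-tabulate {suc m} g = cong (g Fin.zero ∙_) (foldr-tabulate (g ∘ Fin.suc))

module _ {c ℓ} (M : CommutativeMonoid c ℓ) where
  open CommutativeMonoid M using (Carrier; _≈_; ε; ∙-congˡ; identityʳ) renaming (trans to ≈-trans)
  open MonoidSum M using (sum; sum-remove; sum-cong-≋; sum-replicate-zero)

  sum-concentrated : ∀ {m} (t : Vector.Vector Carrier m) i → (∀ j → j ≢ i → t j ≈ ε) → sum t ≈ t i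
  sum-concentrated {suc m} t i t≈ε = ≈-trans (sum-remove {i = i} t) (≈-trans
    (∙-congˡ (≈-trans (sum-cong-≋ (λ j → t≈ε (punchIn i j) (punchInᵢ≢i i j))) (sum-replicate-zero m)))
    (identityʳ (t i)))

sum-pairs : ∀ n (F : ℕ → ℚ) → (∀ q → q < n → F (2 ℕ.* q) + F (suc (2 ℕ.* q)) ≡ 0ℚ) →
            Vector.foldr _+_ 0ℚ {2 ℕ.* n} (λ x → F (toℕ x)) ≡ 0ℚ
sum-pairs zero    F pairs = refl
sum-pairs (suc n) F pairs = subst (λ d → Vector.foldr _+_ 0ℚ {d} (λ x → F (toℕ x)) ≡ 0ℚ) (sym (*-suc 2 n))
  (trans (sym (ℚP.+-assoc (F 0) (F 1) _)) (cong₂ _+_ (pairs 0 (s≤s z≤n)) (sum-pairs n (F ∘ suc ∘ suc) pairs′)))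
  where
  pairs′ : ∀ q → q < n → F (suc (suc (2 ℕ.* q))) + F (suc (suc (suc (2 ℕ.* q)))) ≡ 0ℚ
  pairs′ q q<n = subst (λ t → F t + F (suc t) ≡ 0ℚ) (*-suc 2 q) (pairs (suc q) (s≤s q<n))

record IsLinear {I : Set} (φ : (I → ℚ) → ℚ) : Set where
  field
    pointwise   : ∀ {x y} → (∀ t → x t ≡ y t) → φ x ≡ φ y
    additive    : ∀ x y → φ (λ t → x t + y t) ≡ φ x + φ y
    homogeneous : ∀ c x → φ (λ t → c * x t) ≡ c * φ x

  preserves-sumBy : ∀ {X : Set} (w : X → ℚ) (f : X → I → ℚ) xs →
                 φ (λ t → sumBy (λ a → w a * f a t) xs) ≡ sumBy (λ a → w a * φ (f a)) xs
  preserves-sumBy w f [] = trans (homogeneous 0ℚ (λ _ → 0ℚ)) (ℚP.*-zeroˡ (φ (λ _ → 0ℚ)))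
  preserves-sumBy w f (a ∷ xs) = trans (additive _ _) (cong₂ _+_ (homogeneous (w a) (f a)) (preserves-sumBy w f xs))

proj-isLinear : ∀ d k → IsLinear (λ x → proj d x k)
proj-isLinear zero k = record { pointwise = λ x≗y → x≗y k ; additive = λ _ _ → refl ; homogeneous = λ _ _ → refl }
proj-isLinear (suc m) k = record
  { pointwise   = λ {x} {y} x≗y → cong₂ (λ a s → a - s * w) (x≗y k) (sumBy-cong x≗y (allFin (suc m)))
  ; additive    = λ x y → trans (cong (λ s → x k + y k - s * w) (sumBy-+ x y (allFin (suc m))))
      (solve 5 (λ a b s t w → (a :+ b) :- (s :+ t) :* w := (a :- s :* w) :+ (b :- t :* w)) refl (x k) (y k) (sumV x) (sumV y) w)
  ; homogeneous = λ c x → trans (cong (λ s → c * x k - s * w) (sumBy-* c x (allFin (suc m))))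
      (solve 4 (λ c a s w → c :* a :- (c :* s) :* w := c :* (a :- s :* w)) refl c (x k) (sumV x) w)
  }
  where w = (ℤ+ 1) ℚ./ suc m

proj-balanced : ∀ d (x : Vect d) k → sumV x ≡ 0ℚ → proj d x k ≡ x k
proj-balanced zero x k _ = refl
proj-balanced (suc m) x k Σx≡0 = trans (cong (λ s → x k - s * ((ℤ+ 1) ℚ./ suc m)) Σx≡0)
  (solve 2 (λ a w → a :- con 0ℚ :* w := a) refl (x k) ((ℤ+ 1) ℚ./ suc m))

proj-difference : ∀ d (x : Vect d) a b → proj d x a - proj d x b ≡ x a - x b
proj-difference zero x a b = refl
proj-difference (suc m) x a b = solve 3 (λ u v s → (u :- s) :- (v :- s) := u :- v) refl (x a) (x b) _

contrast : {I : Set} → List (I × I) → (I → ℚ) → ℚ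
contrast ps x = sumBy (λ ab → x (proj₁ ab) - x (proj₂ ab)) ps

contrast-isLinear : ∀ {I : Set} (ps : List (I × I)) → IsLinear (contrast ps)
contrast-isLinear ps = record
  { pointwise   = λ x≗y → sumBy-cong (λ ab → cong₂ _-_ (x≗y (proj₁ ab)) (x≗y (proj₂ ab))) ps
  ; additive    = λ x y → trans (sumBy-cong (λ ab → solve 4 (λ a b c d → (a :+ b) :- (c :+ d) := (a :- c) :+ (b :- d)) refl
      (x (proj₁ ab)) (y (proj₁ ab)) (x (proj₂ ab)) (y (proj₂ ab))) ps) (sumBy-+ _ _ ps)
  ; homogeneous = λ c x → trans (sumBy-cong (λ ab → solve 3 (λ c a b → c :* a :- c :* b := c :* (a :- b)) refl
      c (x (proj₁ ab)) (x (proj₂ ab))) ps) (sumBy-* c _ ps)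
  }

contrast-proj : ∀ {d} (ps : List (Fin d × Fin d)) (x : Vect d) → contrast ps (proj d x) ≡ contrast ps x
contrast-proj {d} ps x = sumBy-cong (λ ab → proj-difference d x (proj₁ ab) (proj₂ ab)) ps

-- The inner point k = suc (toℕ p) owns the coordinates 2k − 1 (left) and 2k (right),
-- numbered from 1 as in the definition of gvec.
data Side : Set where
  left right : Side

point : ∀ {n} → Fin n → Fin (2 ℕ.+ n)
point p = Fin.suc (inject₁ p)

toℕ-point : ∀ {n} (p : Fin n) → toℕ (point p) ≡ suc (toℕ p)
toℕ-point p = cong suc (toℕ-inject₁ p)

coordℕ : Side → ℕ → ℕ
coordℕ left  q = suc (2 ℕ.* q)
coordℕ right q = suc (suc (2 ℕ.* q))

1+2*m<2*n : ∀ {m n} → m < n → suc (2 ℕ.* m) < 2 ℕ.* n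
1+2*m<2*n {m} {n} m<n = subst (_≤ 2 ℕ.* n) (*-suc 2 m) (ℕP.*-monoʳ-≤ 2 m<n)

coord : ∀ {n} → Side → Fin n → Fin (2 ℕ.* n)
coord left  p = fromℕ< (ℕP.*-monoʳ-< 2 (toℕ<n p))
coord right p = fromℕ< (1+2*m<2*n (toℕ<n p))

suc-toℕ-coord : ∀ {n} s (p : Fin n) → suc (toℕ (coord s p)) ≡ coordℕ s (toℕ p)
suc-toℕ-coord left  p = cong suc (toℕ-fromℕ< _)
suc-toℕ-coord right p = cong suc (toℕ-fromℕ< _)

coordℕ-surjective : ∀ t → ∃₂ λ s q → suc t ≡ coordℕ s q
coordℕ-surjective zero = left , 0 , refl
coordℕ-surjective (suc t) with coordℕ-surjective t
... | left  , q , e = right , q , cong suc e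
... | right , q , e = left , suc q , cong suc (trans e (sym (*-suc 2 q)))

coordℕ-bound : ∀ s q n → coordℕ s q ≤ 2 ℕ.* n → q < n
coordℕ-bound s q n c≤2n = ℕP.*-cancelˡ-< 2 q n (ℕP.≤-trans (left≤ s) c≤2n)
  where
  left≤ : ∀ s → coordℕ left q ≤ coordℕ s q
  left≤ left  = ℕP.≤-refl
  left≤ right = ℕP.n≤1+n _

coordinates : ∀ {n} (x : Fin (2 ℕ.* n)) → ∃₂ λ s (p : Fin n) → suc (toℕ x) ≡ coordℕ s (toℕ p)
coordinates {n} x with coordℕ-surjective (toℕ x)
... | s , q , e = s , fromℕ< q<n , trans e (cong (coordℕ s) (sym (toℕ-fromℕ< q<n)))
  where q<n = coordℕ-bound s q n (subst (_≤ 2 ℕ.* n) e (toℕ<n x))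

gvec₀ : (n : ℕ) → Arc n → ℕ → ℚ
gvec₀ n α c = indicator (inPlus n α c) - indicator (inMinus n α c)

-- The entry of gvec₀ on side s of a point that is the source (S) or the target (T)
-- of the arc, or lies in A (a) or in B (b).
value : Side → (S T a b : Bool) → ℚ
value left  S T a b = indicator (S ∨ a) - indicator (T ∨ b)
value right S T a b = indicator (T ∨ a) - indicator (S ∨ b)

doubled-coordℕ : ∀ s q a → ((coordℕ s q ≡ᵇ 2 ℕ.* a ∸ 1) ∨ (coordℕ s q ≡ᵇ 2 ℕ.* a)) ≡ (suc q ≡ᵇ a)
doubled-coordℕ left  q a = trans (cong₂ _∨_ (1+2*m≡ᵇ2*n∸1 q a) (1+2*m≡ᵇ2*n q a)) (∨-identityʳ _)
doubled-coordℕ right q a = cong₂ _∨_ (2+2*m≡ᵇ2*n∸1 q a) (2+2*m≡ᵇ2*n q a)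

inDoubled-coordℕ : ∀ {n} (S : Subset (2 ℕ.+ n)) s (p : Fin n) →
                   inDoubled S (coordℕ s (toℕ p)) ≡ lookup S (point p)
inDoubled-coordℕ {n} S s p = begin
  inDoubled S c             ≡⟨ foldr-map-allFin _∨_ false f ⟩
  Vector.foldr _∨_ false f  ≡⟨ sum-concentrated ∨-commutativeMonoid f (point p) off ⟩
  f (point p)               ≡⟨ cong (lookup S (point p) ∧_) (doubled {point p} (≡ᵇ-true (sym (toℕ-point p)))) ⟩
  lookup S (point p) ∧ true ≡⟨ ∧-identityʳ _ ⟩
  lookup S (point p)        ∎
  where
  open ≡-Reasoning
  c = coordℕ s (toℕ p)
  f : Fin (2 ℕ.+ n) → Bool
  f a = lookup S a ∧ ((c ≡ᵇ 2 ℕ.* toℕ a ∸ 1) ∨ (c ≡ᵇ 2 ℕ.* toℕ a))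
  doubled : ∀ {a b} → (suc (toℕ p) ≡ᵇ toℕ a) ≡ b → ((c ≡ᵇ 2 ℕ.* toℕ a ∸ 1) ∨ (c ≡ᵇ 2 ℕ.* toℕ a)) ≡ b
  doubled {a} = trans (doubled-coordℕ s (toℕ p) (toℕ a))
  off : ∀ a → a ≢ point p → f a ≡ false
  off a a≢p = trans (cong (lookup S a ∧_) (doubled {a} (≡ᵇ-false λ e →
    a≢p (toℕ-injective (trans (sym e) (sym (toℕ-point p))))))) (∧-zeroʳ _)

source-guard : ∀ k i → (not (i ≡ᵇ 0) ∧ (suc k ≡ᵇ i)) ≡ (suc k ≡ᵇ i)
source-guard k zero    = refl
source-guard k (suc i) = refl

target-guard : ∀ {n} k j → k < n → (not (j ≡ᵇ suc n) ∧ (suc k ≡ᵇ j)) ≡ (suc k ≡ᵇ j)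
target-guard {n} k j k<n with suc k ≟ j
... | yes refl = cong (λ b → not b ∧ (suc k ≡ᵇ suc k)) (≡ᵇ-false {suc k} (ℕP.<⇒≢ (s≤s k<n)))
... | no k≢j   = trans (cong (not (j ≡ᵇ suc n) ∧_) (≡ᵇ-false k≢j)) (trans (∧-zeroʳ _) (sym (≡ᵇ-false k≢j)))

module _ {n} (α : Arc n) (p : Fin n) where
  private
    q = toℕ p

    source-term : ∀ {b} → b ≡ (suc q ≡ᵇ i α) → (not (i α ≡ᵇ 0) ∧ b) ≡ (suc q ≡ᵇ i α)
    source-term e = trans (cong (not (i α ≡ᵇ 0) ∧_) e) (source-guard q (i α))

    target-term : ∀ {b} → b ≡ (suc q ≡ᵇ j α) → (not (j α ≡ᵇ suc n) ∧ b) ≡ (suc q ≡ᵇ j α)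
    target-term e = trans (cong (not (j α ≡ᵇ suc n) ∧_) e) (target-guard q (j α) (toℕ<n p))

    no-source-term : ∀ {b} → b ≡ false → (not (i α ≡ᵇ 0) ∧ b) ≡ false
    no-source-term e = trans (cong (not (i α ≡ᵇ 0) ∧_) e) (∧-zeroʳ _)

    no-target-term : ∀ {b} → b ≡ false → (not (j α ≡ᵇ suc n) ∧ b) ≡ false
    no-target-term e = trans (cong (not (j α ≡ᵇ suc n) ∧_) e) (∧-zeroʳ _)

  gvec₀-coordℕ : ∀ s → gvec₀ n α (coordℕ s q) ≡
    value s (suc q ≡ᵇ i α) (suc q ≡ᵇ j α) (lookup (A α) (point p)) (lookup (B α) (point p))
  gvec₀-coordℕ left = cong₂ (λ a b → indicator a - indicator b)
    (cong₂ _∨_ (source-term (1+2*m≡ᵇ2*n∸1 q (i α)))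
               (cong₂ _∨_ (no-target-term (1+2*m≡ᵇ2*n q (j α))) (inDoubled-coordℕ (A α) left p)))
    (cong₂ _∨_ (no-source-term (1+2*m≡ᵇ2*n q (i α)))
               (cong₂ _∨_ (target-term (1+2*m≡ᵇ2*n∸1 q (j α))) (inDoubled-coordℕ (B α) left p)))
  gvec₀-coordℕ right = cong₂ (λ a b → indicator a - indicator b)
    (cong₂ _∨_ (no-source-term (2+2*m≡ᵇ2*n∸1 q (i α)))
               (cong₂ _∨_ (target-term (2+2*m≡ᵇ2*n q (j α))) (inDoubled-coordℕ (A α) right p)))
    (cong₂ _∨_ (source-term (2+2*m≡ᵇ2*n q (i α)))
               (cong₂ _∨_ (no-target-term (2+2*m≡ᵇ2*n∸1 q (j α))) (inDoubled-coordℕ (B α) right p)))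

  gvec₀-coord : ∀ s → gvec₀ n α (suc (toℕ (coord s p))) ≡
    value s (suc q ≡ᵇ i α) (suc q ≡ᵇ j α) (lookup (A α) (point p)) (lookup (B α) (point p))
  gvec₀-coord s = trans (cong (gvec₀ n α) (suc-toℕ-coord s p)) (gvec₀-coordℕ s)

vTerm : ℕ → ℕ → ℚ
vTerm k c = indicator (c ≡ᵇ 2 ℕ.* k) - indicator (c ≡ᵇ 2 ℕ.* k ∸ 1)

vvec₀ : ℕ → ℕ → ℚ
vvec₀ n c = sumBy (λ k → vTerm (suc (toℕ k)) c) (allFin n)

vTerm-coordℕ : ∀ s q k → vTerm k (coordℕ s q) ≡ value s false (suc q ≡ᵇ k) false false
vTerm-coordℕ left  q k = cong₂ (λ a b → indicator a - indicator b)
  (1+2*m≡ᵇ2*n q k) (trans (1+2*m≡ᵇ2*n∸1 q k) (sym (∨-identityʳ _)))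
vTerm-coordℕ right q k = cong₂ (λ a b → indicator a - indicator b)
  (trans (2+2*m≡ᵇ2*n q k) (sym (∨-identityʳ _))) (2+2*m≡ᵇ2*n∸1 q k)

vvec₀-coordℕ : ∀ {n} s (p : Fin n) → vvec₀ n (coordℕ s (toℕ p)) ≡ value s false true false false
vvec₀-coordℕ {n} s p = begin
  vvec₀ n c                 ≡⟨ foldr-map-allFin _+_ 0ℚ t ⟩
  Vector.foldr _+_ 0ℚ t     ≡⟨ sum-concentrated ℚP.+-0-commutativeMonoid t p off ⟩
  t p                       ≡⟨ trans (vTerm-coordℕ s (toℕ p) (suc (toℕ p)))
                                     (cong (λ b → value s false b false false) (≡ᵇ-true {toℕ p} refl)) ⟩
  value s false true false false ∎
  where
  open ≡-Reasoning
  c = coordℕ s (toℕ p)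
  t : Fin n → ℚ
  t k = vTerm (suc (toℕ k)) c
  no-value : ∀ s → value s false false false false ≡ 0ℚ
  no-value left  = refl
  no-value right = refl
  off : ∀ k → k ≢ p → t k ≡ 0ℚ
  off k k≢p = trans (vTerm-coordℕ s (toℕ p) (suc (toℕ k)))
    (trans (cong (λ b → value s false b false false) (≡ᵇ-false (k≢p ∘ toℕ-injective ∘ sym ∘ ℕP.suc-injective)))
           (no-value s))

vvec-coord : ∀ {n} s (p : Fin n) → vvec n (coord s p) ≡ value s false true false false
vvec-coord {n} s p = trans (cong (vvec₀ n) (suc-toℕ-coord s p)) (vvec₀-coordℕ s p)

vvec-balanced : ∀ n → sumV (vvec n) ≡ 0ℚ
vvec-balanced n = trans (foldr-map-allFin _+_ 0ℚ (vvec n)) (sum-pairs n (λ t → vvec₀ n (suc t)) pair)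
  where
  pair : ∀ q → q < n → vvec₀ n (coordℕ left q) + vvec₀ n (coordℕ right q) ≡ 0ℚ
  pair q q<n = subst (λ r → vvec₀ n (coordℕ left r) + vvec₀ n (coordℕ right r) ≡ 0ℚ) (toℕ-fromℕ< q<n)
    (cong₂ _+_ (vvec₀-coordℕ left (fromℕ< q<n)) (vvec₀-coordℕ right (fromℕ< q<n)))

module _ {n} {α : Arc n} (arcα : IsArc n α) where

  arc-between : ∀ {k} → k ∈ A α ⊎ k ∈ B α → i α < toℕ k × toℕ k < j α
  arc-between {k} = proj₁ (proj₂ (proj₂ (proj₂ arcα)) k)

  arc-covers : ∀ {k} → i α < toℕ k → toℕ k < j α → k ∈ A α ⊎ k ∈ B α
  arc-covers {k} i<k k<j = proj₂ (proj₂ (proj₂ (proj₂ arcα)) k) (i<k , k<j)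

  arc-disjoint : ∀ {k} → k ∈ A α → k ∈ B α → ⊥
  arc-disjoint {k} k∈A k∈B = proj₁ (proj₂ (proj₂ arcα)) k (k∈A , k∈B)

endpoint-not-between : ∀ {i j k : ℕ} → k ≡ i ⊎ k ≡ j → ¬ (i < k × k < j)
endpoint-not-between (inj₁ k≡i) (i<k , _) = ℕP.<-irrefl (sym k≡i) i<k
endpoint-not-between (inj₂ k≡j) (_ , k<j) = ℕP.<-irrefl k≡j k<j

¬-Meets-self : ∀ {n} {α : Arc n} → IsArc n α → ¬ Meets α α
¬-Meets-self arcα (k , inj₁ (k∈A , k∈B))       = arc-disjoint arcα k∈A k∈B
¬-Meets-self arcα (k , inj₂ (inj₁ (k≡ , k∈B))) = endpoint-not-between k≡ (arc-between arcα (inj₂ k∈B))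
¬-Meets-self arcα (k , inj₂ (inj₂ (k∈A , k≡))) = endpoint-not-between k≡ (arc-between arcα (inj₁ k∈A))

module _ {n} {S : ArcSet n} (arcs : AllArcs n S) (compatible : PairwiseCompatible S) {α β : Arc n} (Sα : S α) (Sβ : S β) where

  ¬-crossing : ¬ Crossing α β
  ¬-crossing cross = proj₂ (compatible α β Sα Sβ α≢β) cross
    where
    α≢β : α ≢ β
    α≢β refl = ¬-Meets-self (arcs α Sα) (proj₁ cross)

  ¬-adjacent : j α ≢ i β
  ¬-adjacent j≡i = proj₁ (compatible β α Sβ Sα β≢α) (inj₁ (sym j≡i))
    where
    β≢α : β ≢ α
    β≢α refl = ℕP.<-irrefl (sym j≡i) (proj₁ (arcs α Sα))

∉⇒lookup : ∀ {m} {S : Subset m} {x} → x ∉ S → lookup S x ≡ false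
∉⇒lookup {S = S} {x} x∉S with lookup S x in e
... | true  = ⊥-elim (x∉S (Vecₚ.lookup⇒[]= x S e))
... | false = refl

∈-interval⁺ : ∀ {n m} {x : Fin (2 ℕ.+ n)} → 0 < toℕ x → toℕ x < suc m → x ∈ interval n m
∈-interval⁺ {m = m} {x} 0<x x<1+m = Vecₚ.lookup⇒[]= x _
  (trans (Vecₚ.lookup∘tabulate (λ k → (1 ≤ᵇ toℕ k) ∧ (toℕ k ≤ᵇ m)) x)
         (Equivalence.to T-≡ (Equivalence.from T-∧ (ℕP.≤⇒≤ᵇ 0<x , ℕP.≤⇒≤ᵇ (ℕ.s≤s⁻¹ x<1+m)))))

∈-interval⁻ : ∀ {n m} {x : Fin (2 ℕ.+ n)} → x ∈ interval n m → 0 < toℕ x × toℕ x < suc m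
∈-interval⁻ {m = m} {x} x∈ with Equivalence.to T-∧ (Equivalence.from T-≡
  (trans (sym (Vecₚ.lookup∘tabulate (λ k → (1 ≤ᵇ toℕ k) ∧ (toℕ k ≤ᵇ m)) x)) (Vecₚ.[]=⇒lookup x∈)))
... | 1≤x , x≤m = ℕP.≤ᵇ⇒≤ 1 (toℕ x) 1≤x , s≤s (ℕP.≤ᵇ⇒≤ (toℕ x) m x≤m)

isArc-alpha0 : ∀ n → IsArc n (alpha0 n)
isArc-alpha0 n = s≤s z≤n , s≤s z≤n , (λ _ (k∈∅ , _) → ∉⊥ k∈∅) ,
  λ _ → [ ⊥-elim ∘ ∉⊥ , ⊥-elim ∘ ∉⊥ ] , (λ (0<k , k<1) → ⊥-elim (ℕP.<⇒≱ 0<k (ℕ.s≤s⁻¹ k<1)))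

isArc-alphaUnder : ∀ {n m} → m ≤ n → IsArc n (alphaUnder n m)
isArc-alphaUnder m≤n = s≤s z≤n , s≤s m≤n , (λ _ (_ , k∈∅) → ∉⊥ k∈∅) ,
  λ _ → [ ∈-interval⁻ , ⊥-elim ∘ ∉⊥ ] , (λ (0<k , k<1+m) → inj₁ (∈-interval⁺ 0<k k<1+m))

isArc-alphaOver : ∀ {n m} → m ≤ n → IsArc n (alphaOver n m)
isArc-alphaOver m≤n = s≤s z≤n , s≤s m≤n , (λ _ (k∈∅ , _) → ∉⊥ k∈∅) ,
  λ _ → [ ⊥-elim ∘ ∉⊥ , ∈-interval⁻ ] , (λ (0<k , k<1+m) → inj₂ (∈-interval⁺ 0<k k<1+m))

Tleft-arcs : ∀ n → AllArcs n (Tleft n)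
Tleft-arcs n _ (inj₁ refl)                        = isArc-alpha0 n
Tleft-arcs n _ (inj₂ (_ , _ , m≤n , inj₁ refl)) = isArc-alphaUnder m≤n
Tleft-arcs n _ (inj₂ (_ , _ , m≤n , inj₂ refl)) = isArc-alphaOver m≤n

FanArc : ∀ {n} → Arc n → Set
FanArc α = i α ≡ 0 × (A α ≡ ∅ ⊎ B α ≡ ∅)

Tleft-fan : ∀ {n α} → Tleft n α → FanArc α
Tleft-fan (inj₁ refl)                      = refl , inj₁ refl
Tleft-fan (inj₂ (_ , _ , _ , inj₁ refl)) = refl , inj₂ refl
Tleft-fan (inj₂ (_ , _ , _ , inj₂ refl)) = refl , inj₁ refl

module _ {n} (α β : Arc n) (i-α : i α ≡ 0) (i-β : i β ≡ 0) where

  meets-A-empty : IsArc n β → A α ≡ ∅ → Meets α β → j α < j β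
  meets-A-empty _     A≡∅ (k , inj₁ (k∈A , _))                 = ⊥-elim (∉⊥ (subst (k ∈_) A≡∅ k∈A))
  meets-A-empty _     A≡∅ (k , inj₂ (inj₂ (k∈A , _)))          = ⊥-elim (∉⊥ (subst (k ∈_) A≡∅ k∈A))
  meets-A-empty arc-β _   (k , inj₂ (inj₁ (inj₁ k≡i , k∈B))) =
    ⊥-elim (ℕP.<-irrefl (trans i-β (sym (trans k≡i i-α))) (proj₁ (arc-between arc-β (inj₂ k∈B))))
  meets-A-empty arc-β _   (k , inj₂ (inj₁ (inj₂ k≡j , k∈B))) = subst (_< j β) k≡j (proj₂ (arc-between arc-β (inj₂ k∈B)))

  meets-B-empty : IsArc n α → B β ≡ ∅ → Meets α β → j β < j α
  meets-B-empty _     B≡∅ (k , inj₁ (_ , k∈B))                 = ⊥-elim (∉⊥ (subst (k ∈_) B≡∅ k∈B))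
  meets-B-empty _     B≡∅ (k , inj₂ (inj₁ (_ , k∈B)))          = ⊥-elim (∉⊥ (subst (k ∈_) B≡∅ k∈B))
  meets-B-empty arc-α _   (k , inj₂ (inj₂ (k∈A , inj₁ k≡i))) =
    ⊥-elim (ℕP.<-irrefl (trans i-α (sym (trans k≡i i-β))) (proj₁ (arc-between arc-α (inj₁ k∈A))))
  meets-B-empty arc-α _   (k , inj₂ (inj₂ (k∈A , inj₂ k≡j))) = subst (_< j α) k≡j (proj₂ (arc-between arc-α (inj₁ k∈A)))

fan-compatible : ∀ {n} {α β : Arc n} → IsArc n α → IsArc n β → FanArc α → FanArc β → Compatible α β
fan-compatible {α = α} {β} arc-α arc-β (i-α , side-α) (i-β , side-β) = not-pointed , not-crossing side-α side-β
  where
  not-pointed : ¬ NonPointed α β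
  not-pointed (inj₁ i≡j) = ℕP.<-irrefl (trans i-β (trans (sym i-α) i≡j)) (proj₁ arc-β)
  not-pointed (inj₂ i≡j) = ℕP.<-irrefl (trans i-α (trans (sym i-β) i≡j)) (proj₁ arc-α)
  not-crossing : A α ≡ ∅ ⊎ B α ≡ ∅ → A β ≡ ∅ ⊎ B β ≡ ∅ → ¬ Crossing α β
  not-crossing (inj₁ Aα) (inj₁ Aβ) (αβ , βα) =
    ℕP.<-asym (meets-A-empty α β i-α i-β arc-β Aα αβ) (meets-A-empty β α i-β i-α arc-α Aβ βα)
  not-crossing (inj₁ Aα) (inj₂ Bβ) (αβ , _)  =
    ℕP.<-asym (meets-A-empty α β i-α i-β arc-β Aα αβ) (meets-B-empty α β i-α i-β arc-α Bβ αβ)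
  not-crossing (inj₂ Bα) (inj₁ Aβ) (_ , βα)  =
    ℕP.<-asym (meets-A-empty β α i-β i-α arc-α Aβ βα) (meets-B-empty β α i-β i-α arc-β Bα βα)
  not-crossing (inj₂ Bα) (inj₂ Bβ) (αβ , βα) =
    ℕP.<-asym (meets-B-empty α β i-α i-β arc-α Bβ αβ) (meets-B-empty β α i-β i-α arc-β Bα βα)

Tleft-pairwise : ∀ n → PairwiseCompatible (Tleft n)
Tleft-pairwise n α β Tα Tβ _ = fan-compatible (Tleft-arcs n α Tα) (Tleft-arcs n β Tβ) (Tleft-fan Tα) (Tleft-fan Tβ)

-- Switches

-- x ∈ A α means that α passes above x: a descending arc passes above a point and below the next one.
data Direction : Set where
  descending ascending : Direction

firstSide secondSide : ∀ {n} → Direction → Arc n → Subset (2 ℕ.+ n)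
firstSide  descending = A
firstSide  ascending  = B
secondSide descending = B
secondSide ascending  = A

record Switch {n} (β : Arc n) : Set where
  field
    direction   : Direction
    here next   : Fin n
    toℕ-next    : toℕ next ≡ suc (toℕ here)
    here∈       : point here ∈ firstSide direction β
    next∈       : point next ∈ secondSide direction β

switch-crossing : ∀ {n} {α β : Arc n} t {x y : Fin (2 ℕ.+ n)} → x ∈ firstSide t β → y ∈ secondSide t β →
                  x ∈ secondSide t α → y ∈ firstSide t α ⊎ toℕ y ≡ j α → Crossing α β
switch-crossing descending {x} {y} x∈β y∈β x∈α (inj₁ y∈α) =
  (y , inj₁ (y∈α , y∈β)) , (x , inj₁ (x∈β , x∈α))
switch-crossing descending {x} {y} x∈β y∈β x∈α (inj₂ y≡j) =
  (y , inj₂ (inj₁ (inj₂ y≡j , y∈β))) , (x , inj₁ (x∈β , x∈α))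
switch-crossing ascending  {x} {y} x∈β y∈β x∈α (inj₁ y∈α) =
  (x , inj₁ (x∈α , x∈β)) , (y , inj₁ (y∈β , y∈α))
switch-crossing ascending  {x} {y} x∈β y∈β x∈α (inj₂ y≡j) =
  (x , inj₁ (x∈α , x∈β)) , (y , inj₂ (inj₂ (y∈β , inj₂ y≡j)))

all-or-switch : ∀ {p q} {P : ℕ → Set p} {Q : ℕ → Set q} m → (∀ k → k < m → P k ⊎ Q k) → P 0 →
                (∀ k → k < m → P k) ⊎ ∃ λ k → suc k < m × P k × Q (suc k)
all-or-switch zero          _   _  = inj₁ λ _ ()
all-or-switch (suc zero)    _   P0 = inj₁ λ { zero _ → P0 ; (suc _) (s≤s ()) }
all-or-switch {P = P} (suc (suc m)) P⊎Q P0 with all-or-switch (suc m) (λ k k<m → P⊎Q k (ℕP.m<n⇒m<1+n k<m)) P0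
... | inj₂ (k , k+1<m , Pk , Qk+1) = inj₂ (k , ℕP.m<n⇒m<1+n k+1<m , Pk , Qk+1)
... | inj₁ all with P⊎Q (suc m) ℕP.≤-refl
...   | inj₁ Pm = inj₁ λ k k<2+m → [ all k , (λ k≡m → subst P (sym k≡m) Pm) ] (ℕP.m<1+n⇒m<n∨m≡n k<2+m)
...   | inj₂ Qm = inj₂ (m , ℕP.≤-refl , all m ℕP.≤-refl , Qm)

inner : ∀ {n q} → q < n → Fin (2 ℕ.+ n)
inner q<n = point (fromℕ< q<n)

toℕ-inner : ∀ {n q} (q<n : q < n) → toℕ (inner q<n) ≡ suc q
toℕ-inner q<n = trans (toℕ-point (fromℕ< q<n)) (cong suc (toℕ-fromℕ< q<n))

as-inner : ∀ {n q} {x : Fin (2 ℕ.+ n)} → toℕ x ≡ suc q → (q<n : q < n) → x ≡ inner q<n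
as-inner x≡ q<n = toℕ-injective (trans x≡ (sym (toℕ-inner q<n)))

-- fromℕ< ignores its (irrelevant) bound, so this quantification costs nothing.
InnerIn : ∀ {n} → Subset (2 ℕ.+ n) → ℕ → Set
InnerIn {n} S q = (q<n : q < n) → inner q<n ∈ S

arc-≡ : ∀ {n} {β : Arc n} {i′ j′ A′ B′} →
        i β ≡ i′ → j β ≡ j′ → A β ≡ A′ → B β ≡ B′ → β ≡ arc i′ j′ A′ B′
arc-≡ refl refl refl refl = refl

module _ {n} {β : Arc n} (arcβ : IsArc n β) (i≡0 : i β ≡ 0) {m} (j≡ : j β ≡ suc m) where
  private
    m≤n : m ≤ n
    m≤n = ℕ.s≤s⁻¹ (subst (_≤ suc n) j≡ (proj₁ (proj₂ arcβ)))

    sides : ∀ t {x} → x ∈ A β ⊎ x ∈ B β → x ∈ firstSide t β ⊎ x ∈ secondSide t β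
    sides descending = λ x∈ → x∈
    sides ascending  = swap

    sides⁻ : ∀ t {x} → x ∈ firstSide t β ⊎ x ∈ secondSide t β → x ∈ A β ⊎ x ∈ B β
    sides⁻ descending = λ x∈ → x∈
    sides⁻ ascending  = swap

    sides-disjoint : ∀ t {x} → x ∈ firstSide t β → x ∈ secondSide t β → ⊥
    sides-disjoint descending x∈A x∈B = arc-disjoint arcβ x∈A x∈B
    sides-disjoint ascending  x∈B x∈A = arc-disjoint arcβ x∈A x∈B

  inner-range : ∀ {x} → x ∈ A β ⊎ x ∈ B β → 0 < toℕ x × toℕ x < suc m
  inner-range x∈ with arc-between arcβ x∈
  ... | i<x , x<j = subst (_< _) i≡0 i<x , subst (_ <_) j≡ x<j

  inner-covered : ∀ t {q} → q < m → (q<n : q < n) → inner q<n ∈ firstSide t β ⊎ inner q<n ∈ secondSide t β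
  inner-covered t q<m q<n = sides t (arc-covers arcβ
    (subst₂ _<_ (sym i≡0) (sym (toℕ-inner q<n)) (s≤s z≤n)) (subst₂ _<_ (sym (toℕ-inner q<n)) (sym j≡) (s≤s q<m)))

  one-sided : ∀ t → (∀ q → q < m → InnerIn (firstSide t β) q) →
              firstSide t β ≡ interval n m × secondSide t β ≡ ∅
  one-sided t all-first = ⊆-antisym first⊆ ⊆first , Empty-unique λ (x , x∈second) →
    sides-disjoint t (uncurry′ in-first (inner-range (sides⁻ t (inj₂ x∈second)))) x∈second
    where
    in-first : ∀ {x} → 0 < toℕ x → toℕ x < suc m → x ∈ firstSide t β
    in-first {x} 0<x x<1+m with toℕ x in x≡
    ... | zero  = ⊥-elim (ℕP.<-irrefl refl 0<x)
    ... | suc q = subst (_∈ firstSide t β) (sym (as-inner x≡ q<n)) (all-first q q<m q<n)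
      where
      q<m = ℕ.s≤s⁻¹ x<1+m
      q<n = ℕP.<-≤-trans q<m m≤n
    first⊆ : ∀ {x} → x ∈ firstSide t β → x ∈ interval n m
    first⊆ x∈ = uncurry′ ∈-interval⁺ (inner-range (sides⁻ t (inj₁ x∈)))
    ⊆first : ∀ {x} → x ∈ interval n m → x ∈ firstSide t β
    ⊆first x∈ = uncurry′ in-first (∈-interval⁻ x∈)

  private
    fan : 1 ≤ m → ∀ t → firstSide t β ≡ interval n m × secondSide t β ≡ ∅ → Tleft n β
    fan 1≤m descending (A≡ , B≡) = inj₂ (m , 1≤m , m≤n , inj₁ (arc-≡ i≡0 j≡ A≡ B≡))
    fan 1≤m ascending  (B≡ , A≡) = inj₂ (m , 1≤m , m≤n , inj₂ (arc-≡ i≡0 j≡ A≡ B≡))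

    scan : 1 ≤ m → ∀ t → InnerIn (firstSide t β) 0 → Tleft n β ⊎ Switch β
    scan 1≤m t first-0 with all-or-switch {P = InnerIn (firstSide t β)} {Q = InnerIn (secondSide t β)} m
      (λ q q<m → ⊎-map const const (inner-covered t q<m (ℕP.<-≤-trans q<m m≤n))) first-0
    ... | inj₁ all = inj₁ (fan 1≤m t (one-sided t all))
    ... | inj₂ (q , q+1<m , first-q , second-q+1) = inj₂ (record
      { direction   = t
      ; here        = fromℕ< q<n
      ; next        = fromℕ< q+1<n
      ; toℕ-next    = trans (toℕ-fromℕ< q+1<n) (cong suc (sym (toℕ-fromℕ< q<n)))
      ; here∈       = first-q q<n
      ; next∈       = second-q+1 q+1<n
      })
      where
      q+1<n = ℕP.<-≤-trans q+1<m m≤n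
      q<n   = ℕP.<-trans (ℕP.n<1+n q) q+1<n

  fan-or-switch-inner : 1 ≤ m → Tleft n β ⊎ Switch β
  fan-or-switch-inner 1≤m =
    [ scan 1≤m descending ∘ const , scan 1≤m ascending ∘ const ] (inner-covered descending 1≤m (ℕP.<-≤-trans 1≤m m≤n))

fan-or-switch : ∀ {n} {β : Arc n} → IsArc n β → i β ≡ 0 → Tleft n β ⊎ Switch β
fan-or-switch {n} {β} arcβ i≡0 = by-target (j β) refl
  where
  by-target : ∀ J → j β ≡ J → Tleft n β ⊎ Switch β
  by-target zero          j≡ = ⊥-elim (ℕP.n≮0 (subst₂ _<_ i≡0 j≡ (proj₁ arcβ)))
  by-target (suc zero)    j≡ = inj₁ (inj₁ (arc-≡ i≡0 j≡ (nothing-in inj₁) (nothing-in inj₂)))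
    where
    nothing-in : ∀ {S} → (∀ {x} → x ∈ S → x ∈ A β ⊎ x ∈ B β) → S ≡ ∅
    nothing-in into = Empty-unique λ (_ , x∈) →
      uncurry′ (λ 0<x x<1 → ℕP.<⇒≱ 0<x (ℕ.s≤s⁻¹ x<1)) (inner-range arcβ i≡0 j≡ (into x∈))
  by-target (suc (suc m)) j≡ = fan-or-switch-inner arcβ i≡0 j≡ (s≤s z≤n)

-- T_← is a wiggly pseudotriangulation

arcEndingAt : ∀ {n} → ℕ → Arc n
arcEndingAt {n} zero    = alpha0 n
arcEndingAt {n} (suc m) = alphaUnder n (suc m)

arcEndingAt-Tleft : ∀ {n} m → m < n → Tleft n (arcEndingAt m)
arcEndingAt-Tleft zero    _   = inj₁ refl
arcEndingAt-Tleft (suc m) m<n = inj₂ (suc m , s≤s z≤n , ℕP.<⇒≤ m<n , inj₁ refl)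

j-arcEndingAt : ∀ {n} m → j (arcEndingAt {n} m) ≡ suc m
j-arcEndingAt zero    = refl
j-arcEndingAt (suc m) = refl

crossingArc : ∀ {n} → Direction → ℕ → Arc n
crossingArc {n} descending m = alphaOver n m
crossingArc {n} ascending  m = alphaUnder n m

crossingArc-Tleft : ∀ {n} t m → 1 ≤ m → m ≤ n → Tleft n (crossingArc t m)
crossingArc-Tleft descending m 1≤m m≤n = inj₂ (m , 1≤m , m≤n , inj₂ refl)
crossingArc-Tleft ascending  m 1≤m m≤n = inj₂ (m , 1≤m , m≤n , inj₁ refl)

j-crossingArc : ∀ {n} t m → j (crossingArc {n} t m) ≡ suc m
j-crossingArc descending m = refl
j-crossingArc ascending  m = refl

secondSide-crossingArc : ∀ {n} t m → secondSide t (crossingArc {n} t m) ≡ interval n m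
secondSide-crossingArc descending m = refl
secondSide-crossingArc ascending  m = refl

source-bound : ∀ {n q} {β : Arc n} → IsArc n β → i β ≡ suc q → q < n
source-bound {β = β} arcβ i≡ = ℕ.s≤s⁻¹ (subst (_< suc _) i≡ (ℕP.<-≤-trans (proj₁ arcβ) (proj₁ (proj₂ arcβ))))

point∈interval : ∀ {n} (p : Fin n) → point p ∈ interval n (suc (toℕ p))
point∈interval {n} p = ∈-interval⁺ {n} {suc (toℕ p)}
  (subst (0 <_) (sym (toℕ-point p)) (s≤s z≤n)) (subst (_< suc (suc (toℕ p))) (sym (toℕ-point p)) ℕP.≤-refl)

module _ {n} {S : ArcSet n} (arcs : AllArcs n S) (compatible : PairwiseCompatible S) (Tleft⊆S : Tleft n ⊆A S) where

  -- Every inner point is the target of an arc of T_←, and every switch is crossed by one.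
  ⊇Tleft-source-zero : ∀ {β} → S β → i β ≡ 0
  ⊇Tleft-source-zero {β} Sβ = by-source (i β) refl
    where
    by-source : ∀ I → i β ≡ I → i β ≡ 0
    by-source zero    i≡ = i≡
    by-source (suc q) i≡ = ⊥-elim (¬-adjacent arcs compatible
      (Tleft⊆S _ (arcEndingAt-Tleft q (source-bound (arcs β Sβ) i≡))) Sβ (trans (j-arcEndingAt q) (sym i≡)))

  ⊇Tleft-no-switch : ∀ {β} → S β → ¬ Switch β
  ⊇Tleft-no-switch {β} Sβ sw = ¬-crossing arcs compatible Sγ Sβ (switch-crossing direction here∈ next∈
    (subst (point here ∈_) (sym (secondSide-crossingArc direction m)) (point∈interval here))
    (inj₂ (trans (toℕ-point next) (trans (cong suc toℕ-next) (sym (j-crossingArc direction m))))))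
    where
    open Switch sw
    m = suc (toℕ here)
    Sγ = Tleft⊆S (crossingArc direction m) (crossingArc-Tleft direction m (s≤s z≤n) (toℕ<n here))

Tleft-maximal : ∀ n (S : ArcSet n) → AllArcs n S → Tleft n ⊆A S → PairwiseCompatible S → S ⊆A Tleft n
Tleft-maximal n S arcs Tleft⊆S compatible β Sβ =
  [ id , ⊥-elim ∘ ⊇Tleft-no-switch arcs compatible Tleft⊆S Sβ ]
  (fan-or-switch (arcs β Sβ) (⊇Tleft-source-zero arcs compatible Tleft⊆S Sβ))

Tleft-wpt : ∀ {n} → 1 ≤ n → IsWigglyPseudotriangulation n (Tleft n)
Tleft-wpt {n} 1≤n = Tleft-arcs n , inj₂ (n , 1≤n , ℕP.≤-refl , inj₁ refl) , inj₂ (n , 1≤n , ℕP.≤-refl , inj₂ refl) ,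
  Tleft-pairwise n , λ S arcs Tleft⊆S compatible → Tleft-maximal n S arcs Tleft⊆S compatible

-- v lies in the cone of T_←

½ : ℚ
½ = (ℤ+ 1) ℚ./ 2

-- The arcs of T_← ending at the point suc k, weighted so that their g-vectors add up to vTerm (suc k).
contribution : ∀ {n} → Fin n → List (Arc n × ℚ)
contribution {n} Fin.zero      = (alpha0 n , 1ℚ) ∷ []
contribution {n} k@(Fin.suc _) = (alphaUnder n (toℕ k) , ½) ∷ (alphaOver n (toℕ k) , ½) ∷ []

combination : ∀ n → List (Arc n × ℚ)
combination n = concatMap contribution (allFin n)

Admissible : ∀ n → Arc n × ℚ → Set
Admissible n a = Tleft n (proj₁ a) × Internal n (proj₁ a) × 0ℚ ℚ.≤ proj₂ a

internal : ∀ {n} {α : Arc n} → j α ≢ suc n → Internal n α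
internal j≢ = (λ α≡ → j≢ (cong j α≡)) , (λ α≡ → j≢ (cong j α≡))

contribution-admissible : ∀ {n} (k : Fin n) → All (Admissible n) (contribution k)
contribution-admissible Fin.zero = (inj₁ refl , internal (λ ()) , ℚP.≤ᵇ⇒≤ _) ∷ []
contribution-admissible {n} k@(Fin.suc _) =
  (inj₂ (toℕ k , s≤s z≤n , ℕP.<⇒≤ (toℕ<n k) , inj₁ refl) , internal j≢ , ℚP.≤ᵇ⇒≤ _) ∷
  (inj₂ (toℕ k , s≤s z≤n , ℕP.<⇒≤ (toℕ<n k) , inj₂ refl) , internal j≢ , ℚP.≤ᵇ⇒≤ _) ∷ []
  where
  j≢ : suc (toℕ k) ≢ suc n
  j≢ = ℕP.<⇒≢ (s≤s (toℕ<n k))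

combination-admissible : ∀ n → All (Admissible n) (combination n)
combination-admissible n = All.concat⁺ (All.map⁺ (All.tabulate⁺ contribution-admissible))

½-pair : ∀ s X Y → (X ≡ true → Y ≡ false) →
         ½ * value s false X Y false + (½ * value s false X false Y + 0ℚ) ≡ value s false X false false
½-pair s     true  true  X→¬Y = case X→¬Y refl of λ ()
½-pair left  true  false _    = refl
½-pair left  false true  _    = refl
½-pair left  false false _    = refl
½-pair right true  false _    = refl
½-pair right false true  _    = refl
½-pair right false false _    = refl

contribution-at : ∀ {n} (k : Fin n) s (p : Fin n) →
  sumBy (λ a → proj₂ a * gvec₀ n (proj₁ a) (coordℕ s (toℕ p))) (contribution k) ≡ vTerm (suc (toℕ k)) (coordℕ s (toℕ p))
contribution-at {n} Fin.zero s p = begin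
  1ℚ * gvec₀ n (alpha0 n) c + 0ℚ
    ≡⟨ cong (λ g → 1ℚ * g + 0ℚ) (trans (gvec₀-coordℕ (alpha0 n) p s) (cong₂ (value s false X) ∅p ∅p)) ⟩
  1ℚ * value s false X false false + 0ℚ
    ≡⟨ trans (ℚP.+-identityʳ _) (ℚP.*-identityˡ _) ⟩
  value s false X false false
    ≡⟨ sym (vTerm-coordℕ s (toℕ p) 1) ⟩
  vTerm 1 c ∎
  where
  open ≡-Reasoning
  c = coordℕ s (toℕ p)
  X = suc (toℕ p) ≡ᵇ 1
  ∅p = Vecₚ.lookup-replicate (point p) false
contribution-at {n} k@(Fin.suc _) s p = begin
  ½ * gvec₀ n (alphaUnder n m) c + (½ * gvec₀ n (alphaOver n m) c + 0ℚ)
    ≡⟨ cong₂ (λ u o → ½ * u + (½ * o + 0ℚ))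
         (trans (gvec₀-coordℕ (alphaUnder n m) p s) (cong (value s false X Y) ∅p))
         (trans (gvec₀-coordℕ (alphaOver n m) p s) (cong (λ a → value s false X a Y) ∅p)) ⟩
  ½ * value s false X Y false + (½ * value s false X false Y + 0ℚ)
    ≡⟨ ½-pair s X Y X→¬Y ⟩
  value s false X false false
    ≡⟨ sym (vTerm-coordℕ s (toℕ p) (suc m)) ⟩
  vTerm (suc m) c ∎
  where
  open ≡-Reasoning
  m = toℕ k
  c = coordℕ s (toℕ p)
  X = suc (toℕ p) ≡ᵇ suc m
  Y = lookup (interval n m) (point p)
  ∅p = Vecₚ.lookup-replicate (point p) false
  X→¬Y : X ≡ true → Y ≡ false
  X→¬Y X≡ = ∉⇒lookup λ p∈ → ℕP.<-irrefl (trans (toℕ-point p) (≡ᵇ-sound X≡)) (proj₂ (∈-interval⁻ p∈))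

contribution-gvec₀ : ∀ {n} (k : Fin n) (x : Fin (2 ℕ.* n)) →
  sumBy (λ a → proj₂ a * gvec₀ n (proj₁ a) (suc (toℕ x))) (contribution k) ≡ vTerm (suc (toℕ k)) (suc (toℕ x))
contribution-gvec₀ {n} k x with coordinates x
... | s , p , x≡ = subst (λ c → sumBy (λ a → proj₂ a * gvec₀ n (proj₁ a) c) (contribution k) ≡ vTerm (suc (toℕ k)) c)
                         (sym x≡) (contribution-at k s p)

Tleft-cone : ∀ n → InCone n (Tleft n) (vvec n)
Tleft-cone n = combination n , combination-admissible n , λ x → sym (represents x)
  where
  represents : ∀ x → sumBy (λ a → proj₂ a * gvec n (proj₁ a) x) (combination n) ≡ vvec n x
  represents x = begin
    sumBy (λ a → proj₂ a * proj (2 ℕ.* n) (g₀ (proj₁ a)) x) (combination n)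
      ≡⟨ sym (preserves-sumBy proj₂ (g₀ ∘ proj₁) (combination n)) ⟩
    proj (2 ℕ.* n) (λ t → sumBy (λ a → proj₂ a * g₀ (proj₁ a) t) (combination n)) x
      ≡⟨ pointwise (λ t → trans (sumBy-concatMap _ contribution (allFin n))
                                (sumBy-cong (λ k → contribution-gvec₀ k t) (allFin n))) ⟩
    proj (2 ℕ.* n) (vvec n) x
      ≡⟨ proj-balanced (2 ℕ.* n) (vvec n) x (vvec-balanced n) ⟩
    vvec n x ∎
    where
    open ≡-Reasoning
    open IsLinear (proj-isLinear (2 ℕ.* n) x)
    g₀ : Arc n → Vect (2 ℕ.* n)
    g₀ α t = gvec₀ n α (suc (toℕ t))

-- Uniqueness

*-nonneg : ∀ {c x} → 0ℚ ℚ.≤ c → 0ℚ ℚ.≤ x → 0ℚ ℚ.≤ c * x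
*-nonneg {c} 0≤c 0≤x = subst (ℚ._≤ c * _) (ℚP.*-zeroʳ c) (ℚP.*-monoˡ-≤-nonNeg c {{ℚ.nonNegative 0≤c}} 0≤x)

cone-contrast : ∀ {n} {T : ArcSet n} {w} (ps : List (Fin (2 ℕ.* n) × Fin (2 ℕ.* n))) → InCone n T w →
                (∀ α → T α → 0ℚ ℚ.≤ contrast ps (gvec n α)) → 0ℚ ℚ.≤ contrast ps w
cone-contrast {n} ps (cs , admissible , w≡) nonneg =
  subst (0ℚ ℚ.≤_) (sym (trans (pointwise w≡) (preserves-sumBy proj₂ (gvec n ∘ proj₁) cs)))
    (sumBy-nonneg _ (λ {a} (Ta , _ , 0≤c) → *-nonneg 0≤c (nonneg (proj₁ a) Ta)) admissible)
  where open IsLinear (contrast-isLinear ps)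

source-contrast-nonneg : ∀ S a b → 0ℚ ℚ.≤ (value left S false a b - value right S false a b) + 0ℚ
source-contrast-nonneg true  true  true  = ℚP.≤ᵇ⇒≤ _
source-contrast-nonneg true  true  false = ℚP.≤ᵇ⇒≤ _
source-contrast-nonneg true  false true  = ℚP.≤ᵇ⇒≤ _
source-contrast-nonneg true  false false = ℚP.≤ᵇ⇒≤ _
source-contrast-nonneg false true  true  = ℚP.≤ᵇ⇒≤ _
source-contrast-nonneg false true  false = ℚP.≤ᵇ⇒≤ _
source-contrast-nonneg false false true  = ℚP.≤ᵇ⇒≤ _
source-contrast-nonneg false false false = ℚP.≤ᵇ⇒≤ _

data Position : Set where
  inA inB target beyond : Position

valueAt : Side → Position → ℚ
valueAt s inA    = value s false false true  false
valueAt s inB    = value s false false false true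
valueAt s target = value s false true  false false
valueAt s beyond = value s false false false false

Located : ∀ {n} → Arc n → Fin n → Position → Set
Located α p inA    = point p ∈ A α
Located α p inB    = point p ∈ B α
Located α p target = suc (toℕ p) ≡ j α
Located α p beyond = j α < suc (toℕ p)

value-cong : ∀ s {S S′ T T′ a a′ b b′} →
             S ≡ S′ → T ≡ T′ → a ≡ a′ → b ≡ b′ → value s S T a b ≡ value s S′ T′ a′ b′
value-cong s refl refl refl refl = refl

module _ {n} {α : Arc n} (arcα : IsArc n α) where

  before-target : ∀ {p : Fin n} → point p ∈ A α ⊎ point p ∈ B α → suc (toℕ p) < j α
  before-target {p} p∈ = subst (_< j α) (toℕ-point p) (proj₂ (arc-between arcα p∈))

  reached : ∀ {p : Fin n} → point p ∈ A α ⊎ point p ∈ B α → suc (toℕ p) ≤ j α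
  reached = ℕP.<⇒≤ ∘ before-target

  module _ (i≡0 : i α ≡ 0) (p : Fin n) where
    private
      not-source : (suc (toℕ p) ≡ᵇ i α) ≡ false
      not-source = cong (suc (toℕ p) ≡ᵇ_) i≡0

      not-target : point p ∈ A α ⊎ point p ∈ B α → (suc (toℕ p) ≡ᵇ j α) ≡ false
      not-target = ≡ᵇ-false ∘ ℕP.<⇒≢ ∘ before-target

      values : ∀ {T a b} → (suc (toℕ p) ≡ᵇ j α) ≡ T → lookup (A α) (point p) ≡ a → lookup (B α) (point p) ≡ b →
               ∀ s → gvec₀ n α (suc (toℕ (coord s p))) ≡ value s false T a b
      values T≡ a≡ b≡ s = trans (gvec₀-coord α p s) (value-cong s not-source T≡ a≡ b≡)

    locate : ∃ λ pos → Located α p pos × (∀ s → gvec₀ n α (suc (toℕ (coord s p))) ≡ valueAt s pos)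
    locate with point p ∈? A α | point p ∈? B α
    ... | yes p∈A | yes p∈B = ⊥-elim (arc-disjoint arcα p∈A p∈B)
    ... | yes p∈A | no  p∉B = inA , p∈A , values (not-target (inj₁ p∈A)) (Vecₚ.[]=⇒lookup p∈A) (∉⇒lookup p∉B)
    ... | no  p∉A | yes p∈B = inB , p∈B , values (not-target (inj₂ p∈B)) (∉⇒lookup p∉A) (Vecₚ.[]=⇒lookup p∈B)
    ... | no  p∉A | no  p∉B with ℕP.<-cmp (suc (toℕ p)) (j α)
    ...   | tri< p<j _ _ = ⊥-elim ([ p∉A , p∉B ] (arc-covers arcα
            (subst₂ _<_ (sym i≡0) (sym (toℕ-point p)) (s≤s z≤n)) (subst (_< j α) (sym (toℕ-point p)) p<j)))
    ...   | tri≈ _ p≡j _ = target , p≡j , values (≡ᵇ-true p≡j) (∉⇒lookup p∉A) (∉⇒lookup p∉B)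
    ...   | tri> _ p≢j j<p = beyond , j<p , values (≡ᵇ-false p≢j) (∉⇒lookup p∉A) (∉⇒lookup p∉B)

data Consecutive : Position → Position → Set where
  A→A           : Consecutive inA inA
  A→B           : Consecutive inA inB
  B→A           : Consecutive inB inA
  B→B           : Consecutive inB inB
  A→target      : Consecutive inA target
  B→target      : Consecutive inB target
  target→beyond : Consecutive target beyond
  beyond→beyond : Consecutive beyond beyond

module _ {n} {p p′ : Fin n} (p′≡ : toℕ p′ ≡ suc (toℕ p)) {j : ℕ} where

  inside-then-beyond : suc (toℕ p) < j → j < suc (toℕ p′) → ⊥
  inside-then-beyond p<j j<p′ = ℕP.<⇒≱ p<j (ℕ.s≤s⁻¹ (subst (j <_) (cong suc p′≡) j<p′))

  target-then-reached : suc (toℕ p) ≡ j → suc (toℕ p′) ≤ j → ⊥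
  target-then-reached p≡j p′≤j = ℕP.<-irrefl refl (subst₂ _≤_ (cong suc p′≡) (sym p≡j) p′≤j)

  beyond-then-reached : j < suc (toℕ p) → suc (toℕ p′) ≤ j → ⊥
  beyond-then-reached j<p p′≤j = ℕP.<-asym j<p (subst (_≤ j) (cong suc p′≡) p′≤j)

consecutive : ∀ {n} {α : Arc n} {p p′ : Fin n} {pos pos′} → IsArc n α → toℕ p′ ≡ suc (toℕ p) →
              Located α p pos → Located α p′ pos′ → Consecutive pos pos′
consecutive {pos = inA}    {inA}    _    _   _ _  = A→A
consecutive {pos = inA}    {inB}    _    _   _ _  = A→B
consecutive {pos = inB}    {inA}    _    _   _ _  = B→A
consecutive {pos = inB}    {inB}    _    _   _ _  = B→B
consecutive {pos = inA}    {target} _    _   _ _  = A→target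
consecutive {pos = inB}    {target} _    _   _ _  = B→target
consecutive {pos = target} {beyond} _    _   _ _  = target→beyond
consecutive {pos = beyond} {beyond} _    _   _ _  = beyond→beyond
consecutive {pos = inA}    {beyond} arcα p′≡ l l′ = ⊥-elim (inside-then-beyond p′≡ (before-target arcα (inj₁ l)) l′)
consecutive {pos = inB}    {beyond} arcα p′≡ l l′ = ⊥-elim (inside-then-beyond p′≡ (before-target arcα (inj₂ l)) l′)
consecutive {pos = target} {inA}    arcα p′≡ l l′ = ⊥-elim (target-then-reached p′≡ l (reached arcα (inj₁ l′)))
consecutive {pos = target} {inB}    arcα p′≡ l l′ = ⊥-elim (target-then-reached p′≡ l (reached arcα (inj₂ l′)))
consecutive {pos = target} {target} arcα p′≡ l l′ = ⊥-elim (target-then-reached p′≡ l (ℕP.≤-reflexive l′))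
consecutive {pos = beyond} {inA}    arcα p′≡ l l′ = ⊥-elim (beyond-then-reached p′≡ l (reached arcα (inj₁ l′)))
consecutive {pos = beyond} {inB}    arcα p′≡ l l′ = ⊥-elim (beyond-then-reached p′≡ l (reached arcα (inj₂ l′)))
consecutive {pos = beyond} {target} arcα p′≡ l l′ = ⊥-elim (beyond-then-reached p′≡ l (ℕP.≤-reflexive l′))

switchPairs : ∀ {n} → Direction → Fin n → Fin n → List (Fin (2 ℕ.* n) × Fin (2 ℕ.* n))
switchPairs descending p p′ = (coord left p , coord right p′) ∷ (coord right p , coord right p′) ∷ []
switchPairs ascending  p p′ = (coord left p′ , coord left p) ∷ (coord left p′ , coord right p) ∷ []

switchValue : Direction → Position → Position → ℚ
switchValue descending pos pos′ = (valueAt left pos - valueAt right pos′) + ((valueAt right pos - valueAt right pos′) + 0ℚ)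
switchValue ascending  pos pos′ = (valueAt left pos′ - valueAt left pos) + ((valueAt left pos′ - valueAt right pos) + 0ℚ)

contrast-switchPairs : ∀ {n} t {p p′ : Fin n} (x : Vect (2 ℕ.* n)) {pos pos′} →
  (∀ s → x (coord s p) ≡ valueAt s pos) → (∀ s → x (coord s p′) ≡ valueAt s pos′) →
  contrast (switchPairs t p p′) x ≡ switchValue t pos pos′
contrast-switchPairs descending x x≡ x′≡ =
  cong₂ (λ a b → a + (b + 0ℚ)) (cong₂ _-_ (x≡ left) (x′≡ right)) (cong₂ _-_ (x≡ right) (x′≡ right))
contrast-switchPairs ascending  x x≡ x′≡ =
  cong₂ (λ a b → a + (b + 0ℚ)) (cong₂ _-_ (x′≡ left) (x≡ left)) (cong₂ _-_ (x′≡ left) (x≡ right))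

switchValue-target-negative : ∀ t → ¬ 0ℚ ℚ.≤ switchValue t target target
switchValue-target-negative descending = ℚP.≤⇒≤ᵇ
switchValue-target-negative ascending  = ℚP.≤⇒≤ᵇ

secondPosition : Direction → Position
secondPosition descending = inB
secondPosition ascending  = inA

-- The hypothesis rules out exactly the arcs that cross a t-switch at these two points.
switchValue-nonneg : ∀ t {pos pos′} → Consecutive pos pos′ → (pos ≡ secondPosition t → pos′ ≡ secondPosition t) →
                     0ℚ ℚ.≤ switchValue t pos pos′
switchValue-nonneg descending A→A           _    = ℚP.≤ᵇ⇒≤ _
switchValue-nonneg descending A→B           _    = ℚP.≤ᵇ⇒≤ _
switchValue-nonneg descending B→A           stay = case stay refl of λ ()
switchValue-nonneg descending B→B           _    = ℚP.≤ᵇ⇒≤ _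
switchValue-nonneg descending A→target      _    = ℚP.≤ᵇ⇒≤ _
switchValue-nonneg descending B→target      stay = case stay refl of λ ()
switchValue-nonneg descending target→beyond _    = ℚP.≤ᵇ⇒≤ _
switchValue-nonneg descending beyond→beyond _    = ℚP.≤ᵇ⇒≤ _
switchValue-nonneg ascending  A→A           _    = ℚP.≤ᵇ⇒≤ _
switchValue-nonneg ascending  A→B           stay = case stay refl of λ ()
switchValue-nonneg ascending  B→A           _    = ℚP.≤ᵇ⇒≤ _
switchValue-nonneg ascending  B→B           _    = ℚP.≤ᵇ⇒≤ _
switchValue-nonneg ascending  A→target      stay = case stay refl of λ ()
switchValue-nonneg ascending  B→target      _    = ℚP.≤ᵇ⇒≤ _
switchValue-nonneg ascending  target→beyond _    = ℚP.≤ᵇ⇒≤ _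
switchValue-nonneg ascending  beyond→beyond _    = ℚP.≤ᵇ⇒≤ _

stays-second : ∀ {n} {α : Arc n} {p p′ : Fin n} t {pos pos′} → pos ≡ secondPosition t → Consecutive pos pos′ →
  Located α p pos → Located α p′ pos′ →
  (point p ∈ secondSide t α → point p′ ∈ firstSide t α ⊎ toℕ (point p′) ≡ j α → ⊥) → pos′ ≡ secondPosition t
stays-second         descending refl B→B      _ _  _     = refl
stays-second         descending refl B→A      l l′ cross = ⊥-elim (cross l (inj₁ l′))
stays-second {p′ = p′} descending refl B→target l l′ cross = ⊥-elim (cross l (inj₂ (trans (toℕ-point p′) l′)))
stays-second         ascending  refl A→A      _ _  _     = refl
stays-second         ascending  refl A→B      l l′ cross = ⊥-elim (cross l (inj₁ l′))
stays-second {p′ = p′} ascending  refl A→target l l′ cross = ⊥-elim (cross l (inj₂ (trans (toℕ-point p′) l′)))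

module _ {n} {T : ArcSet n} (arcs : AllArcs n T) (compatible : PairwiseCompatible T) (cone : InCone n T (vvec n)) where

  -- No arc of T ends at the source k ≥ 1 of an arc of T, so the two coordinates of k separate v from the cone.
  cone-source-zero : ∀ {β} → T β → i β ≡ 0
  cone-source-zero {β} Tβ = by-source (i β) refl
    where
    by-source : ∀ I → i β ≡ I → i β ≡ 0
    by-source zero    i≡ = i≡
    by-source (suc q) i≡ = ⊥-elim (ℚP.≤⇒≤ᵇ (subst (0ℚ ℚ.≤_) v-contrast (cone-contrast ps cone nonneg)))
      where
      q<n = source-bound (arcs β Tβ) i≡
      p = fromℕ< q<n
      ps = (coord left p , coord right p) ∷ []
      v-contrast : contrast ps (vvec n) ≡ (valueAt left target - valueAt right target) + 0ℚ
      v-contrast = cong₂ (λ a b → (a - b) + 0ℚ) (vvec-coord left p) (vvec-coord right p)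
      nonneg : ∀ α → T α → 0ℚ ℚ.≤ contrast ps (gvec n α)
      nonneg α Tα = subst (0ℚ ℚ.≤_) (sym (trans (contrast-proj ps _) (cong₂ (λ a b → (a - b) + 0ℚ)
        (trans (gvec₀-coord α p left) (cong (λ T′ → value left S T′ a b) not-target))
        (trans (gvec₀-coord α p right) (cong (λ T′ → value right S T′ a b) not-target)))))
        (source-contrast-nonneg S a b)
        where
        S = suc (toℕ p) ≡ᵇ i α
        a = lookup (A α) (point p)
        b = lookup (B α) (point p)
        not-target : (suc (toℕ p) ≡ᵇ j α) ≡ false
        not-target = ≡ᵇ-false λ p≡j → ¬-adjacent arcs compatible Tα Tβ
          (trans (sym p≡j) (trans (cong suc (toℕ-fromℕ< q<n)) (sym i≡)))

  cone-no-switch : ∀ {β} → T β → ¬ Switch β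
  cone-no-switch {β} Tβ sw = switchValue-target-negative direction
    (subst (0ℚ ℚ.≤_) v-contrast (cone-contrast (switchPairs direction here next) cone nonneg))
    where
    open Switch sw
    v-contrast = contrast-switchPairs direction (vvec n) (λ s → vvec-coord s here) (λ s → vvec-coord s next)
    nonneg : ∀ α → T α → 0ℚ ℚ.≤ contrast (switchPairs direction here next) (gvec n α)
    nonneg α Tα with locate (arcs α Tα) (cone-source-zero Tα) here | locate (arcs α Tα) (cone-source-zero Tα) next
    ... | pos , l , g≡ | pos′ , l′ , g′≡ =
      subst (0ℚ ℚ.≤_) (sym (trans (contrast-proj (switchPairs direction here next) g₀)
                                  (contrast-switchPairs direction g₀ g≡ g′≡)))
        (switchValue-nonneg direction cons λ second → stays-second direction second cons l l′ cross)
      where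
      g₀ : Vect (2 ℕ.* n)
      g₀ x = gvec₀ n α (suc (toℕ x))
      cons = consecutive (arcs α Tα) toℕ-next l l′
      cross : point here ∈ secondSide direction α → point next ∈ firstSide direction α ⊎ toℕ (point next) ≡ j α → ⊥
      cross here∈α next∈α = ¬-crossing arcs compatible Tα Tβ (switch-crossing direction here∈ next∈ here∈α next∈α)

  cone-⊆-Tleft : T ⊆A Tleft n
  cone-⊆-Tleft β Tβ = [ id , ⊥-elim ∘ cone-no-switch Tβ ] (fan-or-switch (arcs β Tβ) (cone-source-zero Tβ))

lemma3p10 : (n : ℕ) → 1 ≤ n →
    IsWigglyPseudotriangulation n (Tleft n)
    × InCone n (Tleft n) (vvec n)
    × (∀ (T : ArcSet n) → IsWigglyPseudotriangulation n T → InCone n T (vvec n) →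
         (T ⊆A Tleft n) × (Tleft n ⊆A T))
lemma3p10 n 1≤n = Tleft-wpt 1≤n , Tleft-cone n , uniqueness
  where
  uniqueness : ∀ (T : ArcSet n) → IsWigglyPseudotriangulation n T → InCone n T (vvec n) → (T ⊆A Tleft n) × (Tleft n ⊆A T)
  uniqueness T (arcs , _ , _ , compatible , maximal) cone =
    cone-⊆-Tleft arcs compatible cone , maximal (Tleft n) (Tleft-arcs n) (cone-⊆-Tleft arcs compatible cone) (Tleft-pairwise n)
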